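{- In the algebra $\mathbb{C}_{0,b;q}[x,y]$, for every $n\in\mathbb{N}_0$, \[ \prod_{\overrightarrow{k=0}}^{n-1}\left( by +\frac{(bq^2;q^{ -1})_k}{(b;q^{ -1})_k}\,x\right) =\sum_{k=0}^n \begin{bmatrix}n\\k\end{bmatrix}_{0,b;q} \frac{(bq^{k+2};q)_{n-1}}{(bq^2;q)_{n-1}}\,q^{k(k-n)}\,x^k (by)^{n-k}, \] where the product is taken from left to right as $k$ increases (the factor with $k=0$ leftmost), and coefficients are written to the left.
   Context: $q$ is a fixed generic complex number; for a base $r$ ($r=q$ or $q^{ -1}$), $(u;r)_n=\prod_{j=0}^{n-1}(1-ur^j)$ for $n\ge1$, $(u;r)_0=1$, and $(u_1,\dots,u_m;r)_n=\prod_i(u_i;r)_n$. The $b;q$-binomial coefficient is $\begin{bmatrix}n\\k\end{bmatrix}_{0,b;q}=\frac{(q^{1+k},bq^{1+k};q)_{n-k}}{(q,bq^{1+2k};q)_{n-k}}$. $\mathbb{C}_{0,b;q}[x,y]$ is the unital associative algebra over $\mathbb{C}$ generated by $x$, $y$ and a variable $b$ (with rational functions of $b$ as coefficients), subject to $yx=\frac{1-bq}{1-bq^3}\,q\,xy$, $xb=q^2bx$, $yb=qby$. -}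

module Defs where

open import Level using (Level; _⊔_) renaming (suc to lsuc)
open import Data.Nat using (ℕ; zero; suc; _∸_; _*_; _+_)
open import Data.Product using (∃)
open import Algebra.Bundles using (CommutativeRing; Ring)
open import Algebra.Morphism.Structures using (module RingMorphisms)

pow : ∀ {a} {A : Set a} → (A → A → A) → A → A → ℕ → A
pow _·_ one u zero    = one
pow _·_ one u (suc n) = pow _·_ one u n · u

prodL : ∀ {a} {A : Set a} → (A → A → A) → A → (ℕ → A) → ℕ → A
prodL _·_ one f zero    = one
prodL _·_ one f (suc n) = prodL _·_ one f n · f n

sumTo : ∀ {a} {A : Set a} → (A → A → A) → (ℕ → A) → ℕ → A
sumTo _+_ f zero    = f zero
sumTo _+_ f (suc n) = sumTo _+_ f n + f (suc n)

-- K plays the role of the coefficient field C(b) of rational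
-- functions of b (q a fixed generic complex number); σ is the substitution
-- f(b) ↦ f(qb); A is an associative unital ring receiving K (coefficients,
-- written on the left) and containing x, y subject to the defining relations
-- of C_{0,b;q}[x,y].  Quantifying over all such A is equivalent (universal
-- property of a presentation) to the statement in C_{0,b;q}[x,y] itself.
record Setting (c ℓ c′ ℓ′ : Level) : Set (lsuc (c ⊔ ℓ ⊔ c′ ⊔ ℓ′)) where
  field
    K : CommutativeRing c ℓ
    A : Ring c′ ℓ′
  module K = CommutativeRing K
  module A = Ring A
  open RingMorphisms K.rawRing K.rawRing using () renaming (IsRingHomomorphism to IsEndo)
  open RingMorphisms K.rawRing A.rawRing using () renaming (IsRingHomomorphism to IsHom)
  field
    q b : K.Carrier
    inv     : K.Carrier → K.Carrier
    inv-unit : ∀ a u → u K.* a K.≈ K.1# → a K.* inv a K.≈ K.1#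
    q-unit   : ∃ λ u → u K.* q K.≈ K.1#
    qm-unit  : ∀ m → ∃ λ u → u K.* (K.1# K.- pow K._*_ K.1# q (suc m)) K.≈ K.1#
    bqm-unit : ∀ m → ∃ λ u → u K.* (K.1# K.- b K.* pow K._*_ K.1# q m) K.≈ K.1#
    bqm-unit⁻ : ∀ m → ∃ λ u → u K.* (K.1# K.- b K.* pow K._*_ K.1# (inv q) m) K.≈ K.1#
    σ       : K.Carrier → K.Carrier
    σ-hom   : IsEndo σ
    σ-b     : σ b K.≈ q K.* b
    σ-q     : σ q K.≈ q
    ι       : K.Carrier → A.Carrier
    ι-hom   : IsHom ι
    x y     : A.Carrier
    rel-x   : ∀ f → x A.* ι f A.≈ ι (σ (σ f)) A.* x
    rel-y   : ∀ f → y A.* ι f A.≈ ι (σ f) A.* y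
    rel-yx  : y A.* x A.≈
              ι ((K.1# K.- b K.* q) K.* inv (K.1# K.- b K.* pow K._*_ K.1# q 3) K.* q)
                A.* (x A.* y)

module Formulas {c ℓ c′ ℓ′} (S : Setting c ℓ c′ ℓ′) where
  open Setting S

  _^K_ : K.Carrier → ℕ → K.Carrier
  u ^K n = pow K._*_ K.1# u n

  _^A_ : A.Carrier → ℕ → A.Carrier
  u ^A n = pow A._*_ A.1# u n

  q⁻¹ : K.Carrier
  q⁻¹ = inv q

  poch : K.Carrier → K.Carrier → ℕ → K.Carrier
  poch u r n = prodL K._*_ K.1# (λ j → K.1# K.- u K.* (r ^K j)) n

  binom : ℕ → ℕ → K.Carrier
  binom n k =
    (poch (q ^K (1 + k)) q (n ∸ k) K.* poch (b K.* q ^K (1 + k)) q (n ∸ k))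
    K.* inv (poch q q (n ∸ k) K.* poch (b K.* q ^K (1 + 2 * k)) q (n ∸ k))

  LHS : ℕ → A.Carrier
  LHS n = prodL A._*_ A.1#
    (λ k → ι b A.* y A.+
           ι (poch (b K.* q ^K 2) q⁻¹ k K.* inv (poch b q⁻¹ k)) A.* x) n

  -- right-hand side:
  -- Σ_{k=0}^n [n k] (bq^{k+2};q)_{n-1}/(bq²;q)_{n-1} q^{k(k-n)} x^k (by)^{n-k}
  -- (q^{k(k-n)} = (q⁻¹)^{k(n-k)} since k ≤ n)
  RHS : ℕ → A.Carrier
  RHS n = sumTo A._+_
    (λ k → ι (binom n k
              K.* poch (b K.* q ^K (k + 2)) q (n ∸ 1)
              K.* inv (poch (b K.* q ^K 2) q (n ∸ 1))
              K.* q⁻¹ ^K (k * (n ∸ k)))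
           A.* (x ^A k) A.* ((ι b A.* y) ^A (n ∸ k))) n

-- Write Y = b y, σ for the substitution b ↦ qb, and a_k for the coefficient of x in the k-th
-- factor.  The relations read  x f = σ²(f) x,  Y f = σ(f) Y  and  Y x = g x Y  with g = ρ q⁻²,
-- hence  Y^m x = γ_m x Y^m  with  γ_m = g σ(g) ⋯ σ^(m-1)(g).  Multiplying the right-hand side
-- for n by Y + a_n x, the monomial C(n,k) x^k Y^(n-k) contributes C(n,k) to x^k Y^(n+1-k) and
-- C(n,k) μ(n,k) to x^(k+1) Y^(n-k), where μ(n,k) = σ^(2k)(σ^(n-k)(a_n) γ_(n-k)).  The theorem
-- thus follows by induction on n from the q-Pascal rule  C(n+1,k+1) = C(n,k+1) + C(n,k) μ(n,k).
-- Both a_n and γ_m telescope, which makes μ(n,k) the explicit ratio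
-- (1 - bq^(2k+1))(1 - bq^(2k+2)) / ((1 - bq^(k+1))(1 - bq^(k+2)) q^(n-k)); after clearing the
-- denominators (products of the units 1 - q^j and 1 - bq^j) the rule is an identity between
-- finite products.

module Submission where

open import Defs
open import Level using (_⊔_)
open import Data.Nat as ℕ using (ℕ; zero; suc; _∸_)
import Data.Nat.Properties as ℕₚ
open import Data.Nat.Tactic.RingSolver using (solve-∀)
open import Data.Product using (∃; _,_)
open import Algebra.Bundles using (CommutativeMonoid; CommutativeRing; Ring)
open import Algebra.Morphism.Structures using (module RingMorphisms)
import Algebra.Morphism.Construct.Composition as Composition
import Algebra.Morphism.Construct.Identity as Identity
import Algebra.Properties.CommutativeSemigroup as CommutativeSemigroupProperties
import Algebra.Properties.Ring as RingProperties
import Algebra.Solver.CommutativeMonoid as CommutativeMonoidSolver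
import Tactic.MonoidSolver as MonoidSolver
open import Relation.Binary.PropositionalEquality as ≡ using (_≡_)

module Products {c ℓ} (M : CommutativeMonoid c ℓ) where
  open CommutativeMonoid M
  open CommutativeSemigroupProperties commutativeSemigroup using (interchange)
  open import Relation.Binary.Reasoning.Setoid setoid

  infixr 8 _^_
  _^_ : Carrier → ℕ → Carrier
  u ^ n = pow _∙_ ε u n

  ^-congˡ : ∀ {u v} n → u ≈ v → u ^ n ≈ v ^ n
  ^-congˡ zero    u≈v = refl
  ^-congˡ (suc n) u≈v = ∙-cong (^-congˡ n u≈v) u≈v

  ^-congʳ : ∀ u {m n} → m ≡ n → u ^ m ≈ u ^ n
  ^-congʳ u ≡.refl = refl

  ^-distribˡ-+-∙ : ∀ u m n → u ^ (m ℕ.+ n) ≈ u ^ m ∙ u ^ n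
  ^-distribˡ-+-∙ u m zero    = trans (^-congʳ u (ℕₚ.+-identityʳ m)) (sym (identityʳ _))
  ^-distribˡ-+-∙ u m (suc n) = begin
    u ^ (m ℕ.+ suc n)      ≈⟨ ^-congʳ u (ℕₚ.+-suc m n) ⟩
    u ^ (m ℕ.+ n) ∙ u      ≈⟨ ∙-congʳ (^-distribˡ-+-∙ u m n) ⟩
    (u ^ m ∙ u ^ n) ∙ u    ≈⟨ assoc _ _ _ ⟩
    u ^ m ∙ (u ^ n ∙ u)    ∎

  ^-distribʳ-∙ : ∀ u v n → (u ∙ v) ^ n ≈ u ^ n ∙ v ^ n
  ^-distribʳ-∙ u v zero    = sym (identityˡ ε)
  ^-distribʳ-∙ u v (suc n) = trans (∙-congʳ (^-distribʳ-∙ u v n)) (interchange _ _ u v)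

  ε^n≈ε : ∀ n → ε ^ n ≈ ε
  ε^n≈ε zero    = refl
  ε^n≈ε (suc n) = trans (identityʳ _) (ε^n≈ε n)

  prodL-cong : ∀ {f g} n → (∀ j → f j ≈ g j) → prodL _∙_ ε f n ≈ prodL _∙_ ε g n
  prodL-cong zero    f≈g = refl
  prodL-cong (suc n) f≈g = ∙-cong (prodL-cong n f≈g) (f≈g n)

module Units {c ℓ} (R : CommutativeRing c ℓ) where
  open CommutativeRing R
  open CommutativeSemigroupProperties *-commutativeSemigroup using (interchange)
  open import Relation.Binary.Reasoning.Setoid setoid

  Unit : Carrier → Set (c ⊔ ℓ)
  Unit a = ∃ λ u → u * a ≈ 1#

  Unit-cong : ∀ {a b} → a ≈ b → Unit a → Unit b
  Unit-cong a≈b (u , ua≈1) = u , trans (*-congˡ (sym a≈b)) ua≈1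

  Unit-1# : Unit 1#
  Unit-1# = 1# , *-identityˡ 1#

  Unit-* : ∀ {a b} → Unit a → Unit b → Unit (a * b)
  Unit-* {a} {b} (u , ua≈1) (v , vb≈1) = u * v , (begin
    (u * v) * (a * b)  ≈⟨ interchange u v a b ⟩
    (u * a) * (v * b)  ≈⟨ *-cong ua≈1 vb≈1 ⟩
    1# * 1#            ≈⟨ *-identityˡ 1# ⟩
    1#                 ∎)

  Unit-^ : ∀ {a} n → Unit a → Unit (pow _*_ 1# a n)
  Unit-^ zero    _  = Unit-1#
  Unit-^ (suc n) ua = Unit-* (Unit-^ n ua) ua

  Unit-prodL : ∀ {f} n → (∀ j → Unit (f j)) → Unit (prodL _*_ 1# f n)
  Unit-prodL zero    _  = Unit-1#
  Unit-prodL (suc n) uf = Unit-* (Unit-prodL n uf) (uf n)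

  module Endomorphism {h : Carrier → Carrier} (h-hom : RingMorphisms.IsRingHomomorphism rawRing rawRing h) where
    open RingMorphisms.IsRingHomomorphism h-hom

    Unit-homo : ∀ {a} → Unit a → Unit (h a)
    Unit-homo {a} (u , ua≈1) = h u , trans (sym (*-homo u a)) (trans (⟦⟧-cong ua≈1) 1#-homo)

    ^-homo : ∀ a n → h (pow _*_ 1# a n) ≈ pow _*_ 1# (h a) n
    ^-homo a zero    = 1#-homo
    ^-homo a (suc n) = trans (*-homo _ a) (*-congʳ (^-homo a n))

  module Inverse (inv : Carrier → Carrier) (inv-unit : ∀ a u → u * a ≈ 1# → a * inv a ≈ 1#) where

    inv-inverseʳ : ∀ {a} → Unit a → a * inv a ≈ 1#
    inv-inverseʳ {a} (u , ua≈1) = inv-unit a u ua≈1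

    inv-inverseˡ : ∀ {a} → Unit a → inv a * a ≈ 1#
    inv-inverseˡ ua = trans (*-comm _ _) (inv-inverseʳ ua)

    *-cancelʳ : ∀ {u a b} → Unit u → a * u ≈ b * u → a ≈ b
    *-cancelʳ {u} {a} {b} uu au≈bu = begin
      a                 ≈⟨ sym (*-identityʳ a) ⟩
      a * 1#            ≈⟨ *-congˡ (sym (inv-inverseʳ uu)) ⟩
      a * (u * inv u)   ≈⟨ sym (*-assoc a u (inv u)) ⟩
      (a * u) * inv u   ≈⟨ *-congʳ au≈bu ⟩
      (b * u) * inv u   ≈⟨ *-assoc b u (inv u) ⟩
      b * (u * inv u)   ≈⟨ *-congˡ (inv-inverseʳ uu) ⟩
      b * 1#            ≈⟨ *-identityʳ b ⟩
      b                 ∎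

    inv-unique : ∀ {a b} → Unit a → a * b ≈ 1# → b ≈ inv a
    inv-unique ua ab≈1 = *-cancelʳ ua (trans (trans (*-comm _ _) ab≈1) (sym (inv-inverseˡ ua)))

    inv-cong : ∀ {a b} → Unit a → a ≈ b → inv a ≈ inv b
    inv-cong ua a≈b = inv-unique (Unit-cong a≈b ua) (trans (*-congʳ (sym a≈b)) (inv-inverseʳ ua))

    inv-1# : inv 1# ≈ 1#
    inv-1# = sym (inv-unique Unit-1# (*-identityˡ 1#))

    inv-distrib-* : ∀ {a b} → Unit a → Unit b → inv (a * b) ≈ inv a * inv b
    inv-distrib-* {a} {b} ua ub = sym (inv-unique (Unit-* ua ub) (begin
      (a * b) * (inv a * inv b)    ≈⟨ interchange a b (inv a) (inv b) ⟩
      (a * inv a) * (b * inv b)    ≈⟨ *-cong (inv-inverseʳ ua) (inv-inverseʳ ub) ⟩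
      1# * 1#                      ≈⟨ *-identityˡ 1# ⟩
      1#                           ∎))

    inv-homo : ∀ {h} → RingMorphisms.IsRingHomomorphism rawRing rawRing h →
               ∀ {a} → Unit a → h (inv a) ≈ inv (h a)
    inv-homo {h} h-hom {a} ua =
      inv-unique (Unit-homo ua) (trans (sym (*-homo a (inv a))) (trans (⟦⟧-cong (inv-inverseʳ ua)) 1#-homo))
      where open RingMorphisms.IsRingHomomorphism h-hom; open Endomorphism h-hom

module Sums {c ℓ} (R : Ring c ℓ) where
  open Ring R
  open import Relation.Binary.Reasoning.Setoid setoid
  open CommutativeMonoidSolver +-commutativeMonoid using (solve; _⊕_; _⊜_)

  sum< : (ℕ → Carrier) → ℕ → Carrier
  sum< f zero    = 0#
  sum< f (suc n) = sum< f n + f n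

  sumTo≈sum< : ∀ f n → sumTo _+_ f n ≈ sum< f (suc n)
  sumTo≈sum< f zero    = sym (+-identityˡ _)
  sumTo≈sum< f (suc n) = +-congʳ (sumTo≈sum< f n)

  sum<-cong : ∀ {f g} n → (∀ k → k ℕ.< n → f k ≈ g k) → sum< f n ≈ sum< g n
  sum<-cong zero    f≈g = refl
  sum<-cong (suc n) f≈g = +-cong (sum<-cong n (λ k k<n → f≈g k (ℕₚ.m<n⇒m<1+n k<n))) (f≈g n (ℕₚ.n<1+n n))

  sum<-distrib-+ : ∀ f g n → sum< (λ k → f k + g k) n ≈ sum< f n + sum< g n
  sum<-distrib-+ f g zero    = sym (+-identityˡ _)
  sum<-distrib-+ f g (suc n) = trans (+-congʳ (sum<-distrib-+ f g n))
    (solve 4 (λ a b c d → (a ⊕ b) ⊕ (c ⊕ d) ⊜ (a ⊕ c) ⊕ (b ⊕ d)) refl (sum< f n) (sum< g n) (f n) (g n))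

  sum<-distribʳ-* : ∀ f c n → sum< f n * c ≈ sum< (λ k → f k * c) n
  sum<-distribʳ-* f c zero    = zeroˡ c
  sum<-distribʳ-* f c (suc n) = trans (distribʳ c _ _) (+-congʳ (sum<-distribʳ-* f c n))

  sum<-suc : ∀ f n → sum< f (suc n) ≈ f 0 + sum< (λ k → f (suc k)) n
  sum<-suc f zero    = trans (+-identityˡ _) (sym (+-identityʳ _))
  sum<-suc f (suc n) = trans (+-congʳ (sum<-suc f n)) (+-assoc _ _ _)

  sum<-pascal : ∀ n {f g h} → h 0 ≈ f 0 → (∀ k → k ℕ.< n → h (suc k) ≈ f (suc k) + g k) → h (suc n) ≈ g n →
                sum< f (suc n) + sum< g (suc n) ≈ sum< h (suc (suc n))
  sum<-pascal n {f} {g} {h} h₀ hₖ hₙ = begin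
    sum< f (suc n) + sum< g (suc n)
      ≈⟨ +-congʳ (sum<-suc f n) ⟩
    (f 0 + F) + (G + g n)
      ≈⟨ solve 4 (λ a b c d → (a ⊕ b) ⊕ (c ⊕ d) ⊜ a ⊕ ((b ⊕ c) ⊕ d)) refl (f 0) F G (g n) ⟩
    f 0 + ((F + G) + g n)
      ≈⟨ +-cong (sym h₀) (+-cong (sym (sum<-distrib-+ _ g n)) (sym hₙ)) ⟩
    h 0 + (sum< (λ k → f (suc k) + g k) n + h (suc n))
      ≈⟨ +-congˡ (+-congʳ (sum<-cong n (λ k k<n → sym (hₖ k k<n)))) ⟩
    h 0 + sum< (λ k → h (suc k)) (suc n)
      ≈⟨ sym (sum<-suc h (suc n)) ⟩
    sum< h (suc (suc n)) ∎
    where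
    F G : Carrier
    F = sum< (λ k → f (suc k)) n
    G = sum< g n

module Proof {c ℓ c′ ℓ′} (S : Setting c ℓ c′ ℓ′) where
  open Setting S
  open Formulas S
  open RingMorphisms using (IsRingHomomorphism)

  σ^ : ℕ → K.Carrier → K.Carrier
  σ^ zero    f = f
  σ^ (suc s) f = σ (σ^ s f)

  σ^-+ : ∀ s t f → σ^ s (σ^ t f) ≡ σ^ (s ℕ.+ t) f
  σ^-+ zero    t f = ≡.refl
  σ^-+ (suc s) t f = ≡.cong σ (σ^-+ s t f)

  B : ℕ → K.Carrier
  B j = K.1# K.- b K.* q ^K j

  a : ℕ → K.Carrier
  a k = poch (b K.* q ^K 2) q⁻¹ k K.* inv (poch b q⁻¹ k)

  ρ : K.Carrier
  ρ = (K.1# K.- b K.* q) K.* inv (K.1# K.- b K.* q ^K 3) K.* q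

  g : K.Carrier
  g = ρ K.* q⁻¹ K.* q⁻¹

  γ : ℕ → K.Carrier
  γ zero    = K.1#
  γ (suc m) = σ^ m g K.* γ m

  μ : ℕ → ℕ → K.Carrier
  μ n k = σ^ (2 ℕ.* k) (σ^ (n ∸ k) (a n) K.* γ (n ∸ k))

  C : ℕ → ℕ → K.Carrier
  C n k = binom n k K.* poch (b K.* q ^K (k ℕ.+ 2)) q (n ∸ 1) K.* inv (poch (b K.* q ^K 2) q (n ∸ 1))
          K.* q⁻¹ ^K (k ℕ.* (n ∸ k))

  module Coefficients where
    open K
    open import Relation.Binary.Reasoning.Setoid setoid
    open import Algebra.Solver.Ring.NaturalCoefficients.Default commutativeSemiring
    open Products *-commutativeMonoid using (^-congˡ; ^-congʳ; ^-distribˡ-+-∙; ^-distribʳ-∙; ε^n≈ε; prodL-cong)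
    open Units K
    open Inverse inv inv-unit
    open CommutativeSemigroupProperties *-commutativeSemigroup using (interchange)
    module σ = IsRingHomomorphism σ-hom

    q-Unit : Unit q
    q-Unit = q-unit

    q⁻¹^*q^ : ∀ n → q⁻¹ ^K n * q ^K n ≈ 1#
    q⁻¹^*q^ n = trans (sym (^-distribʳ-∙ q⁻¹ q n)) (trans (^-congˡ n (inv-inverseˡ q-Unit)) (ε^n≈ε n))

    q^+*q⁻¹^ : ∀ n j → q ^K (n ℕ.+ j) * q⁻¹ ^K n ≈ q ^K j
    q^+*q⁻¹^ n j = begin
      q ^K (n ℕ.+ j) * q⁻¹ ^K n     ≈⟨ *-congʳ (^-distribˡ-+-∙ q n j) ⟩
      (q ^K n * q ^K j) * q⁻¹ ^K n  ≈⟨ solve 3 (λ x y z → (x :* y) :* z := (z :* x) :* y)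
                                              refl (q ^K n) (q ^K j) (q⁻¹ ^K n) ⟩
      (q⁻¹ ^K n * q ^K n) * q ^K j  ≈⟨ *-congʳ (q⁻¹^*q^ n) ⟩
      1# * q ^K j                   ≈⟨ *-identityˡ _ ⟩
      q ^K j                        ∎

    bq^*q^ : ∀ i j → (b * q ^K i) * q ^K j ≈ b * q ^K (i ℕ.+ j)
    bq^*q^ i j = trans (*-assoc _ _ _) (*-congˡ (sym (^-distribˡ-+-∙ q i j)))

    B-split : ∀ i j k → i ℕ.+ j ≡ k → B k ≈ 1# - (b * q ^K i) * q ^K j
    B-split i j k i+j≡k = +-congˡ (-‿cong (sym (trans (bq^*q^ i j) (*-congˡ (^-congʳ q i+j≡k)))))

    B-Unit : ∀ j → Unit (B j)
    B-Unit = bqm-unit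

    poch-suc : ∀ u r m → poch u r (suc m) ≈ (1# - u) * poch (u * r) r m
    poch-suc u r zero = begin
      1# * (1# - u * 1#)  ≈⟨ *-identityˡ _ ⟩
      1# - u * 1#         ≈⟨ +-congˡ (-‿cong (*-identityʳ u)) ⟩
      1# - u              ≈⟨ sym (*-identityʳ _) ⟩
      (1# - u) * 1#       ∎
    poch-suc u r (suc m) = begin
      poch u r (suc m) * (1# - u * (r ^K m * r))
        ≈⟨ *-cong (poch-suc u r m) (+-congˡ (-‿cong (solve 3 (λ u r x → u :* (x :* r) := (u :* r) :* x) refl u r (r ^K m)))) ⟩
      ((1# - u) * poch (u * r) r m) * (1# - (u * r) * r ^K m)
        ≈⟨ *-assoc _ _ _ ⟩
      (1# - u) * (poch (u * r) r m * (1# - (u * r) * r ^K m)) ∎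

    poch-congˡ : ∀ {u v} r m → u ≈ v → poch u r m ≈ poch v r m
    poch-congˡ r m u≈v = prodL-cong m (λ j → +-congˡ (-‿cong (*-congʳ u≈v)))

    poch-bq-Unit : ∀ i m → Unit (poch (b * q ^K i) q m)
    poch-bq-Unit i m = Unit-prodL m (λ j → Unit-cong (B-split i j _ ≡.refl) (B-Unit (i ℕ.+ j)))

    poch-q-Unit : ∀ m → Unit (poch q q m)
    poch-q-Unit m = Unit-prodL m (λ j → Unit-cong (+-congˡ (-‿cong (*-comm _ _))) (qm-unit j))

    poch-b-q⁻¹-Unit : ∀ m → Unit (poch b q⁻¹ m)
    poch-b-q⁻¹-Unit m = Unit-prodL m bqm-unit⁻

    σ^-isRingHomomorphism : ∀ s → IsRingHomomorphism rawRing rawRing (σ^ s)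
    σ^-isRingHomomorphism zero    = Identity.isRingHomomorphism rawRing refl
    σ^-isRingHomomorphism (suc s) = Composition.isRingHomomorphism trans (σ^-isRingHomomorphism s) σ-hom

    module σ^ s = IsRingHomomorphism (σ^-isRingHomomorphism s)

    σ^-q : ∀ s → σ^ s q ≈ q
    σ^-q zero    = refl
    σ^-q (suc s) = trans (σ.⟦⟧-cong (σ^-q s)) σ-q

    σ^-q^ : ∀ s n → σ^ s (q ^K n) ≈ q ^K n
    σ^-q^ s n = trans (Endomorphism.^-homo (σ^-isRingHomomorphism s) q n) (^-congˡ n (σ^-q s))

    σ^-b : ∀ s → σ^ s b ≈ q ^K s * b
    σ^-b zero    = sym (*-identityˡ b)
    σ^-b (suc s) = begin
      σ (σ^ s b)          ≈⟨ σ.⟦⟧-cong (σ^-b s) ⟩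
      σ (q ^K s * b)      ≈⟨ σ.*-homo _ _ ⟩
      σ (q ^K s) * σ b    ≈⟨ *-cong (σ^-q^ 1 s) σ-b ⟩
      q ^K s * (q * b)    ≈⟨ sym (*-assoc _ _ _) ⟩
      q ^K s * q * b      ∎

    σ^-inv : ∀ s {u} → Unit u → σ^ s (inv u) ≈ inv (σ^ s u)
    σ^-inv s = inv-homo (σ^-isRingHomomorphism s)

    σ^-Unit : ∀ s {u} → Unit u → Unit (σ^ s u)
    σ^-Unit s = Endomorphism.Unit-homo (σ^-isRingHomomorphism s)

    σ^-q⁻¹ : ∀ s → σ^ s q⁻¹ ≈ q⁻¹
    σ^-q⁻¹ s = trans (σ^-inv s q-Unit) (inv-cong (σ^-Unit s q-Unit) (σ^-q s))

    σ^-1- : ∀ s u → σ^ s (1# - u) ≈ 1# - σ^ s u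
    σ^-1- s u = trans (σ^.+-homo s _ _) (+-cong (σ^.1#-homo s) (σ^.-‿homo s u))

    σ^-b* : ∀ s u → σ^ s (b * u) ≈ b * (q ^K s * σ^ s u)
    σ^-b* s u = begin
      σ^ s (b * u)              ≈⟨ σ^.*-homo s b u ⟩
      σ^ s b * σ^ s u           ≈⟨ *-congʳ (σ^-b s) ⟩
      (q ^K s * b) * σ^ s u     ≈⟨ solve 3 (λ x y z → (x :* y) :* z := y :* (x :* z)) refl (q ^K s) b (σ^ s u) ⟩
      b * (q ^K s * σ^ s u)     ∎

    σ^-bq^ : ∀ s i → σ^ s (b * q ^K i) ≈ b * q ^K (s ℕ.+ i)
    σ^-bq^ s i = trans (σ^-b* s _) (*-congˡ (trans (*-congˡ (σ^-q^ s i)) (sym (^-distribˡ-+-∙ q s i))))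

    σ^-B : ∀ s j → σ^ s (B j) ≈ B (s ℕ.+ j)
    σ^-B s j = trans (σ^-1- s _) (+-congˡ (-‿cong (σ^-bq^ s j)))

    q^*q⁻¹^ : ∀ t n j → t ≡ n ℕ.+ j → q ^K t * q⁻¹ ^K n ≈ q ^K j
    q^*q⁻¹^ t n j t≡n+j = trans (*-congʳ (^-congʳ q t≡n+j)) (q^+*q⁻¹^ n j)

    σ^-q⁻¹^ : ∀ s n → σ^ s (q⁻¹ ^K n) ≈ q⁻¹ ^K n
    σ^-q⁻¹^ s n = trans (Endomorphism.^-homo (σ^-isRingHomomorphism s) q⁻¹ n) (^-congˡ n (σ^-q⁻¹ s))

    σ^-b*q⁻¹^ : ∀ s n j → s ≡ n ℕ.+ j → σ^ s (b * q⁻¹ ^K n) ≈ b * q ^K j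
    σ^-b*q⁻¹^ s n j s≡n+j =
      trans (σ^-b* s _) (*-congˡ (trans (*-congˡ (σ^-q⁻¹^ s n)) (q^*q⁻¹^ s n j s≡n+j)))

    σ^-bq²*q⁻¹^ : ∀ s n j → s ℕ.+ 2 ≡ n ℕ.+ j → σ^ s ((b * q ^K 2) * q⁻¹ ^K n) ≈ b * q ^K j
    σ^-bq²*q⁻¹^ s n j s+2≡n+j = begin
      σ^ s ((b * q ^K 2) * q⁻¹ ^K n)         ≈⟨ σ^.*-homo s _ _ ⟩
      σ^ s (b * q ^K 2) * σ^ s (q⁻¹ ^K n)    ≈⟨ *-cong (σ^-bq^ s 2) (σ^-q⁻¹^ s n) ⟩
      (b * q ^K (s ℕ.+ 2)) * q⁻¹ ^K n        ≈⟨ *-assoc _ _ _ ⟩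
      b * (q ^K (s ℕ.+ 2) * q⁻¹ ^K n)        ≈⟨ *-congˡ (q^*q⁻¹^ _ n j s+2≡n+j) ⟩
      b * q ^K j                             ∎

    a-suc : ∀ n → a (suc n) ≈ a n * ((1# - (b * q ^K 2) * q⁻¹ ^K n) * inv (1# - b * q⁻¹ ^K n))
    a-suc n = trans (*-congˡ (inv-distrib-* (poch-b-q⁻¹-Unit n) (bqm-unit⁻ n))) (interchange _ _ _ _)

    σ^-a-zero : ∀ s → σ^ s (a 0) ≈ 1#
    σ^-a-zero s = trans (σ^.⟦⟧-cong s (trans (*-identityˡ _) inv-1#)) (σ^.1#-homo s)

    -- a n telescopes to (1 - bq)(1 - bq²) / ((1 - bq^(1-n))(1 - bq^(2-n))).
    σ^-a : ∀ n t → σ^ (n ℕ.+ t) (a n) * (B (suc t) * B (suc (suc t))) ≈ B (suc (n ℕ.+ t)) * B (suc (suc (n ℕ.+ t)))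
    σ^-a zero    t = trans (*-congʳ (σ^-a-zero t)) (*-identityˡ _)
    σ^-a (suc n) t = begin
      σ^ s (a (suc n)) * (B₁ * B₂)
        ≈⟨ *-congʳ σ^-a-suc ⟩
      (σ^ s (a n) * (B₃ * inv B₁)) * (B₁ * B₂)
        ≈⟨ solve 5 (λ A X iY Y Z → (A :* (X :* iY)) :* (Y :* Z) := (A :* (Z :* X)) :* (Y :* iY))
                   refl (σ^ s (a n)) B₃ (inv B₁) B₁ B₂ ⟩
      (σ^ s (a n) * (B₂ * B₃)) * (B₁ * inv B₁)
        ≈⟨ *-cong (*-congʳ (reflexive (≡.cong (λ z → σ^ z (a n)) (≡.sym (ℕₚ.+-suc n t)))))
                  (inv-inverseʳ (B-Unit (suc t))) ⟩
      (σ^ (n ℕ.+ suc t) (a n) * (B₂ * B₃)) * 1#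
        ≈⟨ *-identityʳ _ ⟩
      σ^ (n ℕ.+ suc t) (a n) * (B₂ * B₃)
        ≈⟨ σ^-a n (suc t) ⟩
      B (suc (n ℕ.+ suc t)) * B (suc (suc (n ℕ.+ suc t)))
        ≈⟨ reflexive (≡.cong (λ z → B (suc z) * B (suc (suc z))) (ℕₚ.+-suc n t)) ⟩
      B (suc (suc n ℕ.+ t)) * B (suc (suc (suc n ℕ.+ t))) ∎
      where
      s : ℕ
      s = suc n ℕ.+ t
      B₁ B₂ B₃ : Carrier
      B₁ = B (suc t)
      B₂ = B (suc (suc t))
      B₃ = B (suc (suc (suc t)))
      arith : ∀ n t → suc (n ℕ.+ t) ℕ.+ 2 ≡ n ℕ.+ suc (suc (suc t))
      arith = solve-∀
      σ^-numerator : σ^ s (1# - (b * q ^K 2) * q⁻¹ ^K n) ≈ B₃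
      σ^-numerator = trans (σ^-1- s _) (+-congˡ (-‿cong (σ^-bq²*q⁻¹^ s n (suc (suc (suc t))) (arith n t))))
      σ^-denominator : σ^ s (1# - b * q⁻¹ ^K n) ≈ B₁
      σ^-denominator = trans (σ^-1- s _) (+-congˡ (-‿cong (σ^-b*q⁻¹^ s n (suc t) (≡.sym (ℕₚ.+-suc n t)))))
      σ^-a-suc : σ^ s (a (suc n)) ≈ σ^ s (a n) * (B₃ * inv B₁)
      σ^-a-suc = begin
        σ^ s (a (suc n))
          ≈⟨ trans (σ^.⟦⟧-cong s (a-suc n)) (trans (σ^.*-homo s _ _) (*-congˡ (σ^.*-homo s _ _))) ⟩
        σ^ s (a n) * (σ^ s (1# - (b * q ^K 2) * q⁻¹ ^K n) * σ^ s (inv (1# - b * q⁻¹ ^K n)))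
          ≈⟨ *-congˡ (*-cong σ^-numerator (trans (σ^-inv s (bqm-unit⁻ n))
                                                 (inv-cong (σ^-Unit s (bqm-unit⁻ n)) σ^-denominator))) ⟩
        σ^ s (a n) * (B₃ * inv B₁) ∎

    σ^-g : ∀ m → σ^ m g ≈ (((B (suc m) * inv (B (3 ℕ.+ m))) * q) * q⁻¹) * q⁻¹
    σ^-g m = begin
      σ^ m g
        ≈⟨ σ^.*-homo m _ _ ⟩
      σ^ m (ρ * q⁻¹) * σ^ m q⁻¹
        ≈⟨ *-cong (σ^.*-homo m _ _) (σ^-q⁻¹ m) ⟩
      (σ^ m ρ * σ^ m q⁻¹) * q⁻¹
        ≈⟨ *-congʳ (*-cong (trans (σ^.*-homo m _ _) (*-cong (σ^.*-homo m _ _) (σ^-q m))) (σ^-q⁻¹ m)) ⟩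
      (((σ^ m (1# - b * q) * σ^ m (inv (B 3))) * q) * q⁻¹) * q⁻¹
        ≈⟨ *-congʳ (*-congʳ (*-congʳ (*-cong σ^-numerator σ^-denominator))) ⟩
      (((B (suc m) * inv (B (3 ℕ.+ m))) * q) * q⁻¹) * q⁻¹ ∎
      where
      σ^-numerator : σ^ m (1# - b * q) ≈ B (suc m)
      σ^-numerator = trans (σ^.⟦⟧-cong m (+-congˡ (-‿cong (*-congˡ (sym (*-identityˡ q))))))
                           (trans (σ^-B m 1) (reflexive (≡.cong B (ℕₚ.+-comm m 1))))
      σ^-denominator : σ^ m (inv (B 3)) ≈ inv (B (3 ℕ.+ m))
      σ^-denominator = trans (σ^-inv m (B-Unit 3))
        (inv-cong (σ^-Unit m (B-Unit 3)) (trans (σ^-B m 3) (reflexive (≡.cong B (ℕₚ.+-comm m 3)))))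

    γ-closed : ∀ m → γ m * ((B (suc m) * B (suc (suc m))) * q ^K m) ≈ B 1 * B 2
    γ-closed zero    = trans (*-identityˡ _) (*-identityʳ _)
    γ-closed (suc m) = begin
      (σ^ m g * γ m) * ((B₂ * B₃) * (q ^K m * q))
        ≈⟨ *-congʳ (*-congʳ (σ^-g m)) ⟩
      (((((B₁ * inv B₃) * q) * q⁻¹) * q⁻¹) * γ m) * ((B₂ * B₃) * (q ^K m * q))
        ≈⟨ solve 8 (λ B₁ iB₃ q qi γ B₂ B₃ Qm →
              (((((B₁ :* iB₃) :* q) :* qi) :* qi) :* γ) :* ((B₂ :* B₃) :* (Qm :* q))
              := (γ :* ((B₁ :* B₂) :* Qm)) :* ((B₃ :* iB₃) :* ((q :* qi) :* (qi :* q))))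
            refl B₁ (inv B₃) q q⁻¹ (γ m) B₂ B₃ (q ^K m) ⟩
      (γ m * ((B₁ * B₂) * q ^K m)) * ((B₃ * inv B₃) * ((q * q⁻¹) * (q⁻¹ * q)))
        ≈⟨ *-cong (γ-closed m) (*-cong (inv-inverseʳ (B-Unit (3 ℕ.+ m)))
                                       (*-cong (inv-inverseʳ q-Unit) (inv-inverseˡ q-Unit))) ⟩
      (B 1 * B 2) * (1# * (1# * 1#))
        ≈⟨ trans (*-congˡ (trans (*-identityˡ _) (*-identityˡ _))) (*-identityʳ _) ⟩
      B 1 * B 2 ∎
      where
      B₁ B₂ B₃ : Carrier
      B₁ = B (suc m)
      B₂ = B (suc (suc m))
      B₃ = B (3 ℕ.+ m)

    μ-offset : ∀ k m → μ (k ℕ.+ m) k ≡ σ^ (2 ℕ.* k) (σ^ m (a (k ℕ.+ m)) * γ m)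
    μ-offset k m rewrite ℕₚ.m+n∸m≡n k m = ≡.refl

    μ-closed : ∀ k m → μ (k ℕ.+ m) k * ((B (suc k) * B (suc (suc k))) * q ^K m)
                      ≈ B (suc (2 ℕ.* k)) * B (suc (suc (2 ℕ.* k)))
    μ-closed k m = *-cancelʳ R-Unit (begin
      μ (k ℕ.+ m) k * (Bₖ * q ^K m) * R
        ≈⟨ *-congʳ (*-congʳ (trans (reflexive (μ-offset k m)) (σ^.*-homo (2 ℕ.* k) _ _))) ⟩
      (σa * σγ) * (Bₖ * q ^K m) * R
        ≈⟨ solve 5 (λ X Y P Q R → ((X :* Y) :* (P :* Q)) :* R := (X :* P) :* (Y :* (R :* Q))) refl σa σγ Bₖ (q ^K m) R ⟩
      (σa * Bₖ) * (σγ * (R * q ^K m))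
        ≈⟨ *-cong σ^-a-part σ^-γ-part ⟩
      R * T
        ≈⟨ *-comm R T ⟩
      T * R ∎)
      where
      σa σγ Bₖ R T : Carrier
      σa = σ^ (2 ℕ.* k) (σ^ m (a (k ℕ.+ m)))
      σγ = σ^ (2 ℕ.* k) (γ m)
      Bₖ = B (suc k) * B (suc (suc k))
      R = B (2 ℕ.* k ℕ.+ suc m) * B (2 ℕ.* k ℕ.+ suc (suc m))
      T = B (suc (2 ℕ.* k)) * B (suc (suc (2 ℕ.* k)))
      R-Unit : Unit R
      R-Unit = Unit-* (B-Unit (2 ℕ.* k ℕ.+ suc m)) (B-Unit (2 ℕ.* k ℕ.+ suc (suc m)))
      arith₀ : ∀ k m → 2 ℕ.* k ℕ.+ m ≡ (k ℕ.+ m) ℕ.+ k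
      arith₀ = solve-∀
      arith₁ : ∀ k m → suc ((k ℕ.+ m) ℕ.+ k) ≡ 2 ℕ.* k ℕ.+ suc m
      arith₁ = solve-∀
      arith₂ : ∀ k m → suc (suc ((k ℕ.+ m) ℕ.+ k)) ≡ 2 ℕ.* k ℕ.+ suc (suc m)
      arith₂ = solve-∀
      σ^-a-part : σa * Bₖ ≈ R
      σ^-a-part = begin
        σa * Bₖ
          ≈⟨ *-congʳ (reflexive (≡.trans (σ^-+ (2 ℕ.* k) m _) (≡.cong (λ z → σ^ z (a (k ℕ.+ m))) (arith₀ k m)))) ⟩
        σ^ ((k ℕ.+ m) ℕ.+ k) (a (k ℕ.+ m)) * Bₖ
          ≈⟨ σ^-a (k ℕ.+ m) k ⟩
        B (suc ((k ℕ.+ m) ℕ.+ k)) * B (suc (suc ((k ℕ.+ m) ℕ.+ k)))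
          ≈⟨ reflexive (≡.cong₂ (λ u v → B u * B v) (arith₁ k m) (arith₂ k m)) ⟩
        R ∎
      σ^-γ-part : σγ * (R * q ^K m) ≈ T
      σ^-γ-part = begin
        σγ * (R * q ^K m)
          ≈⟨ *-congˡ (*-cong (*-cong (sym (σ^-B (2 ℕ.* k) (suc m))) (sym (σ^-B (2 ℕ.* k) (suc (suc m)))))
                             (sym (σ^-q^ (2 ℕ.* k) m))) ⟩
        σγ * ((σ^ (2 ℕ.* k) (B (suc m)) * σ^ (2 ℕ.* k) (B (suc (suc m)))) * σ^ (2 ℕ.* k) (q ^K m))
          ≈⟨ sym (trans (σ^.*-homo (2 ℕ.* k) _ _) (*-congˡ (trans (σ^.*-homo (2 ℕ.* k) _ _)
                                                              (*-congʳ (σ^.*-homo (2 ℕ.* k) _ _))))) ⟩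
        σ^ (2 ℕ.* k) (γ m * ((B (suc m) * B (suc (suc m))) * q ^K m))
          ≈⟨ σ^.⟦⟧-cong (2 ℕ.* k) (γ-closed m) ⟩
        σ^ (2 ℕ.* k) (B 1 * B 2)
          ≈⟨ trans (σ^.*-homo (2 ℕ.* k) _ _) (*-cong (σ^-B (2 ℕ.* k) 1) (σ^-B (2 ℕ.* k) 2)) ⟩
        B (2 ℕ.* k ℕ.+ 1) * B (2 ℕ.* k ℕ.+ 2)
          ≈⟨ reflexive (≡.cong₂ (λ u v → B u * B v) (ℕₚ.+-comm (2 ℕ.* k) 1) (ℕₚ.+-comm (2 ℕ.* k) 2)) ⟩
        T ∎

    μ-diagonal-closed : ∀ n → μ n n * (B (suc n) * B (suc (suc n))) ≈ B (suc (2 ℕ.* n)) * B (suc (suc (2 ℕ.* n)))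
    μ-diagonal-closed n = begin
      μ n n * (B (suc n) * B (suc (suc n)))
        ≈⟨ *-cong (reflexive (≡.cong (λ z → μ z n) (≡.sym (ℕₚ.+-identityʳ n)))) (sym (*-identityʳ _)) ⟩
      μ (n ℕ.+ 0) n * ((B (suc n) * B (suc (suc n))) * 1#)
        ≈⟨ μ-closed n 0 ⟩
      B (suc (2 ℕ.* n)) * B (suc (suc (2 ℕ.* n))) ∎

    denominator numerator : ℕ → ℕ → ℕ → Carrier
    denominator k d e = ((poch q q d * poch (b * q ^K (1 ℕ.+ 2 ℕ.* k)) q d) * poch (b * q ^K 2) q e) * q ^K (k ℕ.* d)
    numerator   k d e = (poch (q ^K (1 ℕ.+ k)) q d * poch (b * q ^K (1 ℕ.+ k)) q d) * poch (b * q ^K (k ℕ.+ 2)) q e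

    denominator-Unit : ∀ k d e → Unit (denominator k d e)
    denominator-Unit k d e =
      Unit-* (Unit-* (Unit-* (poch-q-Unit d) (poch-bq-Unit (1 ℕ.+ 2 ℕ.* k) d)) (poch-bq-Unit 2 e)) (Unit-^ (k ℕ.* d) q-Unit)

    C-cleared : ∀ n k {d} → n ∸ k ≡ d → C n k * denominator k d (n ∸ 1) ≈ numerator k d (n ∸ 1)
    C-cleared n k ≡.refl = begin
      ((((X₁ * inv Y₁) * X₂) * inv Y₂) * Q⁻¹) * ((Y₁ * Y₂) * Q)
        ≈⟨ solve 8 (λ X₁ iY₁ X₂ iY₂ iQ Y₁ Y₂ Q →
             ((((X₁ :* iY₁) :* X₂) :* iY₂) :* iQ) :* ((Y₁ :* Y₂) :* Q)
             := (X₁ :* X₂) :* ((Y₁ :* iY₁) :* ((Y₂ :* iY₂) :* (iQ :* Q))))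
           refl X₁ (inv Y₁) X₂ (inv Y₂) Q⁻¹ Y₁ Y₂ Q ⟩
      (X₁ * X₂) * ((Y₁ * inv Y₁) * ((Y₂ * inv Y₂) * (Q⁻¹ * Q)))
        ≈⟨ *-congˡ (*-cong (inv-inverseʳ Y₁-Unit)
                           (*-cong (inv-inverseʳ (poch-bq-Unit 2 (n ∸ 1))) (q⁻¹^*q^ (k ℕ.* (n ∸ k))))) ⟩
      (X₁ * X₂) * (1# * (1# * 1#))
        ≈⟨ trans (*-congˡ (trans (*-identityˡ _) (*-identityˡ _))) (*-identityʳ _) ⟩
      X₁ * X₂ ∎
      where
      X₁ Y₁ X₂ Y₂ Q⁻¹ Q : Carrier
      X₁ = poch (q ^K (1 ℕ.+ k)) q (n ∸ k) * poch (b * q ^K (1 ℕ.+ k)) q (n ∸ k)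
      Y₁ = poch q q (n ∸ k) * poch (b * q ^K (1 ℕ.+ 2 ℕ.* k)) q (n ∸ k)
      X₂ = poch (b * q ^K (k ℕ.+ 2)) q (n ∸ 1)
      Y₂ = poch (b * q ^K 2) q (n ∸ 1)
      Q⁻¹ = q⁻¹ ^K (k ℕ.* (n ∸ k))
      Q = q ^K (k ℕ.* (n ∸ k))
      Y₁-Unit : Unit Y₁
      Y₁-Unit = Unit-* (poch-q-Unit (n ∸ k)) (poch-bq-Unit (1 ℕ.+ 2 ℕ.* k) (n ∸ k))

    C-zero : ∀ n → C n 0 ≈ 1#
    C-zero n = *-cancelʳ P-Unit (begin
      C n 0 * P                         ≈⟨ *-congˡ (sym (*-identityʳ P)) ⟩
      C n 0 * denominator 0 n (n ∸ 1)   ≈⟨ C-cleared n 0 ≡.refl ⟩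
      numerator 0 n (n ∸ 1)             ≈⟨ *-congʳ (*-congʳ (poch-congˡ q n (*-identityˡ q))) ⟩
      P                                 ≈⟨ sym (*-identityˡ P) ⟩
      1# * P                            ∎)
      where
      P : Carrier
      P = (poch q q n * poch (b * q ^K 1) q n) * poch (b * q ^K 2) q (n ∸ 1)
      P-Unit : Unit P
      P-Unit = Unit-* (Unit-* (poch-q-Unit n) (poch-bq-Unit 1 n)) (poch-bq-Unit 2 (n ∸ 1))

    C-diagonal : ∀ n → C n n * poch (b * q ^K 2) q (n ∸ 1) ≈ poch (b * q ^K (n ℕ.+ 2)) q (n ∸ 1)
    C-diagonal n = begin
      C n n * P                                      ≈⟨ *-congˡ (sym empty-factors) ⟩
      C n n * denominator n 0 (n ∸ 1)                ≈⟨ C-cleared n n (ℕₚ.n∸n≡0 n) ⟩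
      (1# * 1#) * poch (b * q ^K (n ℕ.+ 2)) q (n ∸ 1) ≈⟨ trans (*-congʳ (*-identityˡ 1#)) (*-identityˡ _) ⟩
      poch (b * q ^K (n ℕ.+ 2)) q (n ∸ 1)            ∎
      where
      P : Carrier
      P = poch (b * q ^K 2) q (n ∸ 1)
      empty-factors : denominator n 0 (n ∸ 1) ≈ P
      empty-factors = trans (*-congˡ (^-congʳ q (ℕₚ.*-zeroʳ n)))
                            (trans (*-identityʳ _) (trans (*-congʳ (*-identityˡ 1#)) (*-identityˡ P)))

    C-suc-diagonal : ∀ n → C (suc n) (suc n) ≈ C n n * μ n n
    C-suc-diagonal zero    = trans (sym (*-identityʳ _)) (*-congˡ (sym μ-zero))
      where
      μ-zero : μ 0 0 ≈ 1#
      μ-zero = trans (*-identityʳ _) (trans (*-identityˡ _) inv-1#)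
    C-suc-diagonal (suc e) = *-cancelʳ P-Unit (begin
      C (suc n) (suc n) * ((Pₑ * B (suc n)) * B (suc (suc n)))
        ≈⟨ trans (sym (*-assoc _ _ _)) (*-congʳ (*-congˡ (*-congˡ (B-split 2 e (suc n) ≡.refl)))) ⟩
      (C (suc n) (suc n) * poch (b * q ^K 2) q n) * B (suc (suc n))
        ≈⟨ *-congʳ (C-diagonal (suc n)) ⟩
      poch (b * q ^K (suc n ℕ.+ 2)) q n * B (suc (suc n))
        ≈⟨ trans (*-comm _ _) (*-cong (reflexive (≡.cong B (ℕₚ.+-comm 2 n))) (poch-congˡ q n (sym (*-assoc b _ q)))) ⟩
      (1# - u) * poch (u * q) q n
        ≈⟨ sym (poch-suc u q n) ⟩
      (poch u q e * (1# - u * q ^K e)) * (1# - u * q ^K n)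
        ≈⟨ *-cong (*-congˡ (sym (B-split (n ℕ.+ 2) e _ (arith-1 e)))) (sym (B-split (n ℕ.+ 2) n _ (arith-2 e))) ⟩
      (poch u q e * B (suc (2 ℕ.* n))) * B (suc (suc (2 ℕ.* n)))
        ≈⟨ trans (*-assoc _ _ _) (*-cong (sym (C-diagonal n)) (sym (μ-diagonal-closed n))) ⟩
      (C n n * Pₑ) * (μ n n * (B (suc n) * B (suc (suc n))))
        ≈⟨ solve 5 (λ c P μ B₁ B₂ → (c :* P) :* (μ :* (B₁ :* B₂)) := (c :* μ) :* ((P :* B₁) :* B₂))
                   refl (C n n) Pₑ (μ n n) (B (suc n)) (B (suc (suc n))) ⟩
      (C n n * μ n n) * ((Pₑ * B (suc n)) * B (suc (suc n))) ∎)
      where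
      n : ℕ
      n = suc e
      Pₑ u : Carrier
      Pₑ = poch (b * q ^K 2) q e
      u = b * q ^K (n ℕ.+ 2)
      P-Unit : Unit ((Pₑ * B (suc n)) * B (suc (suc n)))
      P-Unit = Unit-* (Unit-* (poch-bq-Unit 2 e) (B-Unit (suc n))) (B-Unit (suc (suc n)))
      arith-1 : ∀ e → (suc e ℕ.+ 2) ℕ.+ e ≡ suc (2 ℕ.* suc e)
      arith-1 = solve-∀
      arith-2 : ∀ e → (suc e ℕ.+ 2) ℕ.+ suc e ≡ suc (suc (2 ℕ.* suc e))
      arith-2 = solve-∀

    denominator-suc : ∀ k d e → denominator k (suc d) (suc e)
                      ≈ denominator k d e * (((1# - q * q ^K d) * q ^K k)
                                             * ((1# - (b * q ^K (1 ℕ.+ 2 ℕ.* k)) * q ^K d) * (1# - (b * q ^K 2) * q ^K e)))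
    denominator-suc k d e = begin
      ((P₁ * X₁) * (P₂ * X₂)) * (P₃ * X₃) * q ^K (k ℕ.* suc d)
        ≈⟨ *-congˡ (trans (^-congʳ q (≡.trans (ℕₚ.*-suc k d) (ℕₚ.+-comm k (k ℕ.* d))))
                          (^-distribˡ-+-∙ q (k ℕ.* d) k)) ⟩
      ((P₁ * X₁) * (P₂ * X₂)) * (P₃ * X₃) * (q ^K (k ℕ.* d) * q ^K k)
        ≈⟨ solve 8 (λ P₁ X₁ P₂ X₂ P₃ X₃ Q Qₖ →
                      ((P₁ :* X₁) :* (P₂ :* X₂)) :* (P₃ :* X₃) :* (Q :* Qₖ)
                      := (((P₁ :* P₂) :* P₃) :* Q) :* ((X₁ :* Qₖ) :* (X₂ :* X₃)))
                   refl P₁ X₁ P₂ X₂ P₃ X₃ (q ^K (k ℕ.* d)) (q ^K k) ⟩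
      denominator k d e * ((X₁ * q ^K k) * (X₂ * X₃)) ∎
      where
      P₁ P₂ P₃ X₁ X₂ X₃ : Carrier
      P₁ = poch q q d
      P₂ = poch (b * q ^K (1 ℕ.+ 2 ℕ.* k)) q d
      P₃ = poch (b * q ^K 2) q e
      X₁ = 1# - q * q ^K d
      X₂ = 1# - (b * q ^K (1 ℕ.+ 2 ℕ.* k)) * q ^K d
      X₃ = 1# - (b * q ^K 2) * q ^K e

    numerator-suc : ∀ k d e → numerator k (suc d) (suc e)
                    ≈ numerator k d e * ((1# - q ^K (1 ℕ.+ k) * q ^K d)
                                         * ((1# - (b * q ^K (1 ℕ.+ k)) * q ^K d) * (1# - (b * q ^K (k ℕ.+ 2)) * q ^K e)))
    numerator-suc k d e =
      solve 6 (λ P₁ X₁ P₂ X₂ P₃ X₃ → ((P₁ :* X₁) :* (P₂ :* X₂)) :* (P₃ :* X₃)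
                                     := ((P₁ :* P₂) :* P₃) :* (X₁ :* (X₂ :* X₃)))
              refl _ _ _ _ _ _

    B-resplit : ∀ i j i′ j′ → i ℕ.+ j ≡ i′ ℕ.+ j′ → 1# - (b * q ^K i) * q ^K j ≈ 1# - (b * q ^K i′) * q ^K j′
    B-resplit i j i′ j′ i+j≡i′+j′ = trans (sym (B-split i j _ ≡.refl)) (B-split i′ j′ _ (≡.sym i+j≡i′+j′))

    1-bq^*q^-Unit : ∀ i j → Unit (1# - (b * q ^K i) * q ^K j)
    1-bq^*q^-Unit i j = Unit-cong (B-split i j _ ≡.refl) (B-Unit (i ℕ.+ j))

    suc-+-∸ : ∀ i m → suc (i ℕ.+ m) ∸ i ≡ suc m
    suc-+-∸ i m = ≡.trans (≡.cong (_∸ i) (≡.sym (ℕₚ.+-suc i m))) (ℕₚ.m+n∸m≡n i (suc m))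

    C-step-n : ∀ i m → C (suc (suc (i ℕ.+ m))) (suc i) * ((1# - q * q ^K m) * q ^K suc i)
                       ≈ C (suc (i ℕ.+ m)) (suc i) * (1# - q ^K (2 ℕ.+ i) * q ^K m)
    C-step-n i m = *-cancelʳ DXY-Unit (begin
      (C N (suc i) * Z) * (D * (X * Y))
        ≈⟨ solve 4 (λ c Z D XY → (c :* Z) :* (D :* XY) := c :* (D :* (Z :* XY))) refl (C N (suc i)) Z D (X * Y) ⟩
      C N (suc i) * (D * (Z * (X * Y)))
        ≈⟨ *-congˡ (sym (denominator-suc (suc i) m (i ℕ.+ m))) ⟩
      C N (suc i) * denominator (suc i) (suc m) n
        ≈⟨ C-cleared N (suc i) (suc-+-∸ i m) ⟩
      numerator (suc i) (suc m) n
        ≈⟨ numerator-suc (suc i) m (i ℕ.+ m) ⟩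
      numerator (suc i) m (i ℕ.+ m) * (P * (X′ * Y′))
        ≈⟨ *-congˡ (*-congˡ (trans (*-cong (B-resplit (2 ℕ.+ i) m 2 (i ℕ.+ m) (arith-1 i m))
                                           (B-resplit (suc i ℕ.+ 2) (i ℕ.+ m) (1 ℕ.+ 2 ℕ.* suc i) m (arith-2 i m)))
                                    (*-comm Y X))) ⟩
      numerator (suc i) m (i ℕ.+ m) * (P * (X * Y))
        ≈⟨ *-congʳ (sym (C-cleared n (suc i) (ℕₚ.m+n∸m≡n i m))) ⟩
      (C n (suc i) * D) * (P * (X * Y))
        ≈⟨ solve 4 (λ c D P XY → (c :* D) :* (P :* XY) := (c :* P) :* (D :* XY)) refl (C n (suc i)) D P (X * Y) ⟩
      (C n (suc i) * P) * (D * (X * Y)) ∎)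
      where
      n N : ℕ
      n = suc (i ℕ.+ m)
      N = suc n
      Z D X Y P X′ Y′ : Carrier
      Z = (1# - q * q ^K m) * q ^K suc i
      D = denominator (suc i) m (i ℕ.+ m)
      X = 1# - (b * q ^K (1 ℕ.+ 2 ℕ.* suc i)) * q ^K m
      Y = 1# - (b * q ^K 2) * q ^K (i ℕ.+ m)
      P = 1# - q ^K (2 ℕ.+ i) * q ^K m
      X′ = 1# - (b * q ^K (2 ℕ.+ i)) * q ^K m
      Y′ = 1# - (b * q ^K (suc i ℕ.+ 2)) * q ^K (i ℕ.+ m)
      DXY-Unit : Unit (D * (X * Y))
      DXY-Unit = Unit-* (denominator-Unit (suc i) m (i ℕ.+ m))
                        (Unit-* (1-bq^*q^-Unit (1 ℕ.+ 2 ℕ.* suc i) m) (1-bq^*q^-Unit 2 (i ℕ.+ m)))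
      arith-1 : ∀ i m → (2 ℕ.+ i) ℕ.+ m ≡ 2 ℕ.+ (i ℕ.+ m)
      arith-1 = solve-∀
      arith-2 : ∀ i m → (suc i ℕ.+ 2) ℕ.+ (i ℕ.+ m) ≡ (1 ℕ.+ 2 ℕ.* suc i) ℕ.+ m
      arith-2 = solve-∀

    numerator-step-k : ∀ i m → numerator i (suc m) (i ℕ.+ m) * (1# - (b * q ^K (1 ℕ.+ 2 ℕ.* i)) * q ^K suc m)
                               ≈ (1# - q ^K suc i) * ((B (suc i) * B (suc (suc i))) * numerator (suc i) m (i ℕ.+ m))
    numerator-step-k i m = begin
      (P₁ * P₂) * P₃ * (1# - (b * q ^K (1 ℕ.+ 2 ℕ.* i)) * q ^K suc m)
        ≈⟨ *-assoc _ _ _ ⟩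
      (P₁ * P₂) * (P₃ * (1# - (b * q ^K (1 ℕ.+ 2 ℕ.* i)) * q ^K suc m))
        ≈⟨ *-cong (*-cong (poch-suc _ q m) (trans (poch-suc _ q m) (*-congˡ (poch-congˡ q m (*-assoc _ _ _)))))
                  (*-congˡ (B-resplit (1 ℕ.+ 2 ℕ.* i) (suc m) (i ℕ.+ 2) (i ℕ.+ m) (arith i m))) ⟩
      ((1# - q ^K suc i) * N₁) * (B (suc i) * N₂) * poch (b * q ^K (i ℕ.+ 2)) q (suc (i ℕ.+ m))
        ≈⟨ *-congˡ (trans (poch-suc _ q (i ℕ.+ m))
                          (*-cong (reflexive (≡.cong B (ℕₚ.+-comm i 2))) (poch-congˡ q (i ℕ.+ m) (*-assoc _ _ _)))) ⟩
      ((1# - q ^K suc i) * N₁) * (B (suc i) * N₂) * (B (suc (suc i)) * N₃)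
        ≈⟨ solve 6 (λ Qᵢ N₁ B₁ N₂ B₂ N₃ → ((Qᵢ :* N₁) :* (B₁ :* N₂)) :* (B₂ :* N₃)
                                           := Qᵢ :* ((B₁ :* B₂) :* ((N₁ :* N₂) :* N₃)))
                   refl (1# - q ^K suc i) N₁ (B (suc i)) N₂ (B (suc (suc i))) N₃ ⟩
      (1# - q ^K suc i) * ((B (suc i) * B (suc (suc i))) * numerator (suc i) m (i ℕ.+ m)) ∎
      where
      P₁ P₂ P₃ N₁ N₂ N₃ : Carrier
      P₁ = poch (q ^K (1 ℕ.+ i)) q (suc m)
      P₂ = poch (b * q ^K (1 ℕ.+ i)) q (suc m)
      P₃ = poch (b * q ^K (i ℕ.+ 2)) q (i ℕ.+ m)
      N₁ = poch (q ^K (2 ℕ.+ i)) q m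
      N₂ = poch (b * q ^K (2 ℕ.+ i)) q m
      N₃ = poch (b * q ^K (suc i ℕ.+ 2)) q (i ℕ.+ m)
      arith : ∀ i m → (1 ℕ.+ 2 ℕ.* i) ℕ.+ suc m ≡ (i ℕ.+ 2) ℕ.+ (i ℕ.+ m)
      arith = solve-∀

    denominator-step-k : ∀ i m → denominator i (suc m) (i ℕ.+ m) * (1# - (b * q ^K (1 ℕ.+ 2 ℕ.* i)) * q ^K suc m) * q ^K m
                                 ≈ denominator (suc i) m (i ℕ.+ m)
                                   * ((1# - q * q ^K m) * (B (suc (2 ℕ.* i)) * B (suc (suc (2 ℕ.* i))))) * q ^K i
    denominator-step-k i m = begin
      ((P₁ * X₁) * poch u q (suc m)) * P₃ * q ^K (i ℕ.* suc m) * (1# - u * q ^K suc m) * q ^K m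
        ≈⟨ solve 6 (λ A P₂ P₃ Q X Qₘ → (((A :* P₂) :* P₃) :* Q) :* X :* Qₘ
                                       := (A :* ((P₂ :* X) :* P₃)) :* (Q :* Qₘ))
                   refl (P₁ * X₁) (poch u q (suc m)) P₃ (q ^K (i ℕ.* suc m)) (1# - u * q ^K suc m) (q ^K m) ⟩
      (P₁ * X₁) * (poch u q (suc (suc m)) * P₃) * (q ^K (i ℕ.* suc m) * q ^K m)
        ≈⟨ *-cong (*-congˡ (*-congʳ two-factors)) powers ⟩
      (P₁ * X₁) * ((F * P₂) * P₃) * (q ^K (suc i ℕ.* m) * q ^K i)
        ≈⟨ solve 7 (λ P₁ X₁ F P₂ P₃ Q Qᵢ → (P₁ :* X₁) :* ((F :* P₂) :* P₃) :* (Q :* Qᵢ)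
                                            := (((P₁ :* P₂) :* P₃) :* Q) :* (X₁ :* F) :* Qᵢ)
                   refl P₁ X₁ F P₂ P₃ (q ^K (suc i ℕ.* m)) (q ^K i) ⟩
      denominator (suc i) m (i ℕ.+ m) * (X₁ * F) * q ^K i ∎
      where
      u P₁ P₂ P₃ X₁ F : Carrier
      u = b * q ^K (1 ℕ.+ 2 ℕ.* i)
      P₁ = poch q q m
      P₂ = poch (b * q ^K (1 ℕ.+ 2 ℕ.* suc i)) q m
      P₃ = poch (b * q ^K 2) q (i ℕ.+ m)
      X₁ = 1# - q * q ^K m
      F = B (suc (2 ℕ.* i)) * B (suc (suc (2 ℕ.* i)))
      arith-1 : ∀ i → suc (suc (suc (2 ℕ.* i))) ≡ 1 ℕ.+ 2 ℕ.* suc i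
      arith-1 = solve-∀
      arith-2 : ∀ i m → i ℕ.* suc m ℕ.+ m ≡ suc i ℕ.* m ℕ.+ i
      arith-2 = solve-∀
      two-factors : poch u q (suc (suc m)) ≈ F * P₂
      two-factors = begin
        poch u q (suc (suc m))
          ≈⟨ trans (poch-suc u q (suc m)) (*-congˡ (poch-suc (u * q) q m)) ⟩
        (1# - u) * ((1# - u * q) * poch ((u * q) * q) q m)
          ≈⟨ *-congˡ (*-cong (+-congˡ (-‿cong (*-assoc _ _ _)))
                             (poch-congˡ q m (trans (*-assoc _ _ _) (trans (*-assoc _ _ _)
                               (*-congˡ (trans (sym (*-assoc _ _ _)) (^-congʳ q (arith-1 i)))))))) ⟩
        (1# - u) * (B (suc (suc (2 ℕ.* i))) * P₂)
          ≈⟨ sym (*-assoc _ _ _) ⟩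
        F * P₂ ∎
      powers : q ^K (i ℕ.* suc m) * q ^K m ≈ q ^K (suc i ℕ.* m) * q ^K i
      powers = trans (sym (^-distribˡ-+-∙ q (i ℕ.* suc m) m))
                     (trans (^-congʳ q (arith-2 i m)) (^-distribˡ-+-∙ q (suc i ℕ.* m) i))

    C-step-k : ∀ i m → (C (suc (i ℕ.+ m)) i * μ (suc (i ℕ.+ m)) i) * ((1# - q * q ^K m) * q ^K suc i)
                       ≈ C (suc (i ℕ.+ m)) (suc i) * (1# - q ^K suc i)
    C-step-k i m = *-cancelʳ DEF-Unit (begin
      (C n i * μ n i) * (X * (q ^K i * q)) * (D * (E * F))
        ≈⟨ solve 8 (λ c μ X Qᵢ q D E F → (c :* μ) :* (X :* (Qᵢ :* q)) :* (D :* (E :* F))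
                                          := c :* ((D :* (X :* F)) :* Qᵢ) :* (μ :* (E :* q)))
                   refl (C n i) (μ n i) X (q ^K i) q D E F ⟩
      C n i * ((D * (X * F)) * q ^K i) * (μ n i * (E * q))
        ≈⟨ *-congʳ (*-congˡ (sym (denominator-step-k i m))) ⟩
      C n i * ((denominator i (suc m) (i ℕ.+ m) * Y) * q ^K m) * (μ n i * (E * q))
        ≈⟨ solve 7 (λ c D Y Qₘ μ E q → c :* ((D :* Y) :* Qₘ) :* (μ :* (E :* q))
                                       := ((c :* D) :* Y) :* (μ :* (E :* (Qₘ :* q))))
                   refl (C n i) (denominator i (suc m) (i ℕ.+ m)) Y (q ^K m) (μ n i) E q ⟩
      ((C n i * denominator i (suc m) (i ℕ.+ m)) * Y) * (μ n i * (E * q ^K suc m))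
        ≈⟨ *-cong (*-congʳ (C-cleared n i (suc-+-∸ i m))) μ-closed′ ⟩
      (numerator i (suc m) (i ℕ.+ m) * Y) * F
        ≈⟨ *-congʳ (numerator-step-k i m) ⟩
      ((1# - q ^K suc i) * (E * numerator (suc i) m (i ℕ.+ m))) * F
        ≈⟨ solve 4 (λ Qᵢ E N F → (Qᵢ :* (E :* N)) :* F := Qᵢ :* (N :* (E :* F))) refl (1# - q ^K suc i) E _ F ⟩
      (1# - q ^K suc i) * (numerator (suc i) m (i ℕ.+ m) * (E * F))
        ≈⟨ *-congˡ (*-congʳ (sym (C-cleared n (suc i) (ℕₚ.m+n∸m≡n i m)))) ⟩
      (1# - q ^K suc i) * ((C n (suc i) * D) * (E * F))
        ≈⟨ solve 5 (λ Qᵢ c D E F → Qᵢ :* ((c :* D) :* (E :* F)) := (c :* Qᵢ) :* (D :* (E :* F)))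
                   refl (1# - q ^K suc i) (C n (suc i)) D E F ⟩
      (C n (suc i) * (1# - q ^K suc i)) * (D * (E * F)) ∎)
      where
      n : ℕ
      n = suc (i ℕ.+ m)
      X Y D E F : Carrier
      X = 1# - q * q ^K m
      Y = 1# - (b * q ^K (1 ℕ.+ 2 ℕ.* i)) * q ^K suc m
      D = denominator (suc i) m (i ℕ.+ m)
      E = B (suc i) * B (suc (suc i))
      F = B (suc (2 ℕ.* i)) * B (suc (suc (2 ℕ.* i)))
      DEF-Unit : Unit (D * (E * F))
      DEF-Unit = Unit-* (denominator-Unit (suc i) m (i ℕ.+ m))
                        (Unit-* (Unit-* (B-Unit (suc i)) (B-Unit (suc (suc i))))
                                (Unit-* (B-Unit (suc (2 ℕ.* i))) (B-Unit (suc (suc (2 ℕ.* i))))))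
      μ-closed′ : μ n i * (E * q ^K suc m) ≈ F
      μ-closed′ = trans (*-congʳ (reflexive (≡.cong (λ z → μ z i) (≡.sym (ℕₚ.+-suc i m))))) (μ-closed i (suc m))

    1-xzy-split : ∀ x y z → (1# - z * y) * x + (1# - x) ≈ 1# - (x * z) * y
    1-xzy-split x y z = begin
      (1# - z * y) * x + (1# - x)              ≈⟨ +-congʳ (distribʳ x 1# (- (z * y))) ⟩
      (1# * x + - (z * y) * x) + (1# - x)
        ≈⟨ +-congʳ (+-cong (*-identityˡ x) (sym (RingProperties.-‿distribˡ-* ring (z * y) x))) ⟩
      (x + - (z * y * x)) + (1# + - x)
        ≈⟨ solve 3 (λ x n nx → (x :+ n) :+ (con 1 :+ nx) := (con 1 :+ n) :+ (x :+ nx)) refl x (- (z * y * x)) (- x) ⟩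
      (1# + - (z * y * x)) + (x + - x)
        ≈⟨ +-congˡ (-‿inverseʳ x) ⟩
      (1# + - (z * y * x)) + 0#
        ≈⟨ +-identityʳ _ ⟩
      1# + - (z * y * x)
        ≈⟨ +-congˡ (-‿cong (solve 3 (λ z y x → z :* y :* x := x :* z :* y) refl z y x)) ⟩
      1# - (x * z) * y ∎

    -- C-step-n and C-step-k add up to the rule multiplied by the unit Z,
    -- since 1 - q^(i+2) q^m = Z + (1 - q^(i+1)).
    C-pascal : ∀ i m → C (suc (suc (i ℕ.+ m))) (suc i)
                       ≈ C (suc (i ℕ.+ m)) (suc i) + C (suc (i ℕ.+ m)) i * μ (suc (i ℕ.+ m)) i
    C-pascal i m = *-cancelʳ Z-Unit (begin
      C (suc n) (suc i) * Z                                      ≈⟨ C-step-n i m ⟩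
      C n (suc i) * (1# - q ^K (2 ℕ.+ i) * q ^K m)              ≈⟨ *-congˡ (sym (1-xzy-split (q ^K suc i) (q ^K m) q)) ⟩
      C n (suc i) * (Z + (1# - q ^K suc i))                      ≈⟨ distribˡ _ Z _ ⟩
      C n (suc i) * Z + C n (suc i) * (1# - q ^K suc i)          ≈⟨ +-congˡ (sym (C-step-k i m)) ⟩
      C n (suc i) * Z + (C n i * μ n i) * Z                      ≈⟨ sym (distribʳ Z _ _) ⟩
      (C n (suc i) + C n i * μ n i) * Z                          ∎)
      where
      n : ℕ
      n = suc (i ℕ.+ m)
      Z : Carrier
      Z = (1# - q * q ^K m) * q ^K suc i
      Z-Unit : Unit Z
      Z-Unit = Unit-* (Unit-cong (+-congˡ (-‿cong (*-comm _ _))) (qm-unit m)) (Unit-^ (suc i) q-Unit)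

    g*σ²b : g * σ (σ b) ≈ b * ρ
    g*σ²b = begin
      ((ρ * q⁻¹) * q⁻¹) * σ (σ b)
        ≈⟨ *-congˡ (trans (σ.⟦⟧-cong σ-b) (trans (σ.*-homo q b) (*-cong σ-q σ-b))) ⟩
      ((ρ * q⁻¹) * q⁻¹) * (q * (q * b))
        ≈⟨ solve 4 (λ ρ qi q b → ((ρ :* qi) :* qi) :* (q :* (q :* b)) := (b :* ρ) :* ((qi :* q) :* (qi :* q)))
                   refl ρ q⁻¹ q b ⟩
      (b * ρ) * ((q⁻¹ * q) * (q⁻¹ * q))
        ≈⟨ *-congˡ (trans (*-cong (inv-inverseˡ q-Unit) (inv-inverseˡ q-Unit)) (*-identityˡ 1#)) ⟩
      (b * ρ) * 1#
        ≈⟨ *-identityʳ _ ⟩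
      b * ρ ∎

  module Relations where
    open A
    open import Relation.Binary.Reasoning.Setoid setoid
    open Coefficients using (g*σ²b; C-zero; C-pascal; C-suc-diagonal; suc-+-∸)
    module ι = IsRingHomomorphism ι-hom

    Y : Carrier
    Y = ι b * y

    x^-ι : ∀ k f → x ^A k * ι f ≈ ι (σ^ (2 ℕ.* k) f) * x ^A k
    x^-ι zero    f = trans (*-identityˡ _) (sym (*-identityʳ _))
    x^-ι (suc k) f = begin
      (x ^A k * x) * ι f                          ≈⟨ *-assoc _ _ _ ⟩
      x ^A k * (x * ι f)                          ≈⟨ *-congˡ (rel-x f) ⟩
      x ^A k * (ι (σ (σ f)) * x)                  ≈⟨ sym (*-assoc _ _ _) ⟩
      (x ^A k * ι (σ (σ f))) * x                  ≈⟨ *-congʳ (x^-ι k _) ⟩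
      (ι (σ^ (2 ℕ.* k) (σ (σ f))) * x ^A k) * x   ≈⟨ *-assoc _ _ _ ⟩
      ι (σ^ (2 ℕ.* k) (σ^ 2 f)) * (x ^A k * x)
        ≈⟨ *-congʳ (ι.⟦⟧-cong (K.reflexive (≡.trans (σ^-+ (2 ℕ.* k) 2 f) (≡.cong (λ s → σ^ s f) (arith k))))) ⟩
      ι (σ^ (2 ℕ.* suc k) f) * (x ^A k * x)       ∎
      where
      arith : ∀ k → 2 ℕ.* k ℕ.+ 2 ≡ 2 ℕ.* suc k
      arith = solve-∀

    Y-ι : ∀ f → Y * ι f ≈ ι (σ f) * Y
    Y-ι f = begin
      (ι b * y) * ι f         ≈⟨ *-assoc _ _ _ ⟩
      ι b * (y * ι f)         ≈⟨ *-congˡ (rel-y f) ⟩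
      ι b * (ι (σ f) * y)     ≈⟨ sym (*-assoc _ _ _) ⟩
      (ι b * ι (σ f)) * y     ≈⟨ *-congʳ (trans (sym (ι.*-homo _ _)) (trans (ι.⟦⟧-cong (K.*-comm _ _)) (ι.*-homo _ _))) ⟩
      (ι (σ f) * ι b) * y     ≈⟨ *-assoc _ _ _ ⟩
      ι (σ f) * Y             ∎

    Y^-ι : ∀ m f → Y ^A m * ι f ≈ ι (σ^ m f) * Y ^A m
    Y^-ι zero    f = trans (*-identityˡ _) (sym (*-identityʳ _))
    Y^-ι (suc m) f = begin
      (Y ^A m * Y) * ι f                ≈⟨ *-assoc _ _ _ ⟩
      Y ^A m * (Y * ι f)                ≈⟨ *-congˡ (Y-ι f) ⟩
      Y ^A m * (ι (σ f) * Y)            ≈⟨ sym (*-assoc _ _ _) ⟩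
      (Y ^A m * ι (σ f)) * Y            ≈⟨ *-congʳ (Y^-ι m _) ⟩
      (ι (σ^ m (σ f)) * Y ^A m) * Y     ≈⟨ *-assoc _ _ _ ⟩
      ι (σ^ m (σ^ 1 f)) * (Y ^A m * Y)
        ≈⟨ *-congʳ (ι.⟦⟧-cong (K.reflexive (≡.trans (σ^-+ m 1 f) (≡.cong (λ s → σ^ s f) (ℕₚ.+-comm m 1))))) ⟩
      ι (σ^ (suc m) f) * (Y ^A m * Y)   ∎

    Y-x : Y * x ≈ ι g * (x * Y)
    Y-x = begin
      (ι b * y) * x                  ≈⟨ *-assoc _ _ _ ⟩
      ι b * (y * x)                  ≈⟨ *-congˡ rel-yx ⟩
      ι b * (ι ρ * (x * y))          ≈⟨ sym (*-assoc _ _ _) ⟩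
      (ι b * ι ρ) * (x * y)          ≈⟨ *-congʳ (trans (sym (ι.*-homo _ _))
                                                       (trans (ι.⟦⟧-cong (K.sym g*σ²b)) (ι.*-homo _ _))) ⟩
      (ι g * ι (σ (σ b))) * (x * y)  ≈⟨ MonoidSolver.solve *-monoid ⟩
      ι g * ((ι (σ (σ b)) * x) * y)  ≈⟨ *-congˡ (*-congʳ (sym (rel-x b))) ⟩
      ι g * ((x * ι b) * y)          ≈⟨ *-congˡ (*-assoc _ _ _) ⟩
      ι g * (x * Y)                  ∎

    Y^-x : ∀ m → Y ^A m * x ≈ ι (γ m) * (x * Y ^A m)
    Y^-x zero    = trans (*-identityˡ _) (sym (trans (*-cong ι.1#-homo (*-identityʳ _)) (*-identityˡ _)))
    Y^-x (suc m) = begin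
      (Y ^A m * Y) * x                                ≈⟨ *-assoc _ _ _ ⟩
      Y ^A m * (Y * x)                                ≈⟨ *-congˡ Y-x ⟩
      Y ^A m * (ι g * (x * Y))                        ≈⟨ sym (*-assoc _ _ _) ⟩
      (Y ^A m * ι g) * (x * Y)                        ≈⟨ *-congʳ (Y^-ι m g) ⟩
      (ι (σ^ m g) * Y ^A m) * (x * Y)                 ≈⟨ MonoidSolver.solve *-monoid ⟩
      ι (σ^ m g) * ((Y ^A m * x) * Y)                 ≈⟨ *-congˡ (*-congʳ (Y^-x m)) ⟩
      ι (σ^ m g) * ((ι (γ m) * (x * Y ^A m)) * Y)     ≈⟨ MonoidSolver.solve *-monoid ⟩
      (ι (σ^ m g) * ι (γ m)) * (x * (Y ^A m * Y))     ≈⟨ *-congʳ (sym (ι.*-homo _ _)) ⟩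
      ι (σ^ m g K.* γ m) * (x * (Y ^A m * Y))         ∎

    ιx^Y^-*-ιx : ∀ c f k m → ((ι c * x ^A k) * Y ^A m) * (ι f * x)
                             ≈ (ι (c K.* σ^ (2 ℕ.* k) (σ^ m f K.* γ m)) * x ^A suc k) * Y ^A m
    ιx^Y^-*-ιx c f k m = begin
      ((ι c * x ^A k) * Y ^A m) * (ι f * x)                     ≈⟨ MonoidSolver.solve *-monoid ⟩
      ι c * (x ^A k * ((Y ^A m * ι f) * x))                     ≈⟨ *-congˡ (*-congˡ (*-congʳ (Y^-ι m f))) ⟩
      ι c * (x ^A k * ((ι (σ^ m f) * Y ^A m) * x))              ≈⟨ *-congˡ (*-congˡ (*-assoc _ _ _)) ⟩
      ι c * (x ^A k * (ι (σ^ m f) * (Y ^A m * x)))              ≈⟨ *-congˡ (*-congˡ (*-congˡ (Y^-x m))) ⟩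
      ι c * (x ^A k * (ι (σ^ m f) * (ι (γ m) * (x * Y ^A m))))  ≈⟨ MonoidSolver.solve *-monoid ⟩
      ι c * ((x ^A k * (ι (σ^ m f) * ι (γ m))) * (x * Y ^A m))  ≈⟨ *-congˡ (*-congʳ (*-congˡ (sym (ι.*-homo _ _)))) ⟩
      ι c * ((x ^A k * ι (σ^ m f K.* γ m)) * (x * Y ^A m))      ≈⟨ *-congˡ (*-congʳ (x^-ι k _)) ⟩
      ι c * ((ι h * x ^A k) * (x * Y ^A m))                     ≈⟨ MonoidSolver.solve *-monoid ⟩
      ((ι c * ι h) * (x ^A k * x)) * Y ^A m                     ≈⟨ *-congʳ (*-congʳ (sym (ι.*-homo _ _))) ⟩
      (ι (c K.* h) * x ^A suc k) * Y ^A m                       ∎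
      where
      h : K.Carrier
      h = σ^ (2 ℕ.* k) (σ^ m f K.* γ m)

    term : ℕ → ℕ → Carrier
    term n k = ι (C n k) * x ^A k * Y ^A (n ∸ k)

    term-zero : ∀ n → term (suc n) 0 ≈ term n 0 * Y
    term-zero n = trans (*-congʳ (*-congʳ (ι.⟦⟧-cong (K.trans (C-zero (suc n)) (K.sym (C-zero n)))))) (sym (*-assoc _ _ _))

    term-diagonal : ∀ n → term (suc n) (suc n) ≈ term n n * (ι (a n) * x)
    term-diagonal n = sym (trans (ιx^Y^-*-ιx (C n n) (a n) n (n ∸ n))
                                 (*-congʳ (*-congʳ (ι.⟦⟧-cong (K.sym (C-suc-diagonal n))))))

    term-pascal : ∀ {n k} → k ℕ.< n → term (suc n) (suc k) ≈ term n (suc k) * Y + term n k * (ι (a n) * x)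
    term-pascal {n} {k} k<n =
      ≡.subst (λ n → term (suc n) (suc k) ≈ term n (suc k) * Y + term n k * (ι (a n) * x))
              (ℕₚ.m+[n∸m]≡n k<n) (sym (split k (n ∸ suc k)))
      where
      split : ∀ k m → term (suc k ℕ.+ m) (suc k) * Y + term (suc k ℕ.+ m) k * (ι (a (suc k ℕ.+ m)) * x)
                      ≈ term (suc (suc k ℕ.+ m)) (suc k)
      split k m = begin
        term n′ (suc k) * Y + term n′ k * (ι (a n′) * x)
          ≈⟨ +-cong (trans (*-assoc _ _ _) (*-congˡ (reflexive (≡.cong (Y ^A_) exponent))))
                    (ιx^Y^-*-ιx (C n′ k) (a n′) k (n′ ∸ k)) ⟩
        (ι (C n′ (suc k)) * x ^A suc k) * Y ^A (n′ ∸ k) + (ι (C n′ k K.* μ n′ k) * x ^A suc k) * Y ^A (n′ ∸ k)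
          ≈⟨ sym (trans (*-congʳ (trans (*-congʳ (ι.+-homo _ _)) (distribʳ _ _ _))) (distribʳ _ _ _)) ⟩
        (ι (C n′ (suc k) K.+ C n′ k K.* μ n′ k) * x ^A suc k) * Y ^A (n′ ∸ k)
          ≈⟨ *-congʳ (*-congʳ (ι.⟦⟧-cong (K.sym (C-pascal k m)))) ⟩
        term (suc n′) (suc k) ∎
        where
        n′ : ℕ
        n′ = suc (k ℕ.+ m)
        exponent : suc ((k ℕ.+ m) ∸ k) ≡ n′ ∸ k
        exponent = ≡.trans (≡.cong suc (ℕₚ.m+n∸m≡n k m)) (≡.sym (suc-+-∸ k m))

mainTheorem3 : ∀ {c ℓ c′ ℓ′} (S : Setting c ℓ c′ ℓ′) (n : ℕ) →
    Ring._≈_ (Setting.A S) (Formulas.LHS S n) (Formulas.RHS S n)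
mainTheorem3 S zero = sym (trans (*-identityʳ _) (trans (*-identityʳ _) (trans (ι.⟦⟧-cong (C-zero 0)) ι.1#-homo)))
  where open Setting S; open A; open Proof S; open Relations; open Coefficients using (C-zero)
mainTheorem3 S (suc n) = begin
  LHS n * (Y + ι (a n) * x)
    ≈⟨ *-congʳ (trans (mainTheorem3 S n) (sumTo≈sum< _ n)) ⟩
  sum< (term n) (suc n) * (Y + ι (a n) * x)
    ≈⟨ trans (distribˡ _ _ _) (+-cong (sum<-distribʳ-* _ _ (suc n)) (sum<-distribʳ-* _ _ (suc n))) ⟩
  sum< (λ k → term n k * Y) (suc n) + sum< (λ k → term n k * (ι (a n) * x)) (suc n)
    ≈⟨ sum<-pascal n (term-zero n) (λ k → term-pascal) (term-diagonal n) ⟩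
  sum< (term (suc n)) (suc (suc n))
    ≈⟨ sym (sumTo≈sum< _ (suc n)) ⟩
  RHS (suc n) ∎
  where
  open Setting S
  open Formulas S
  open A
  open Sums A
  open Proof S
  open Relations
  open import Relation.Binary.Reasoning.Setoid setoid
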